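{- Let $a^2,b^2,c^2,d^2,e^2,f^2,g^2,h^2,i^2$ be a primitive magic square of squares (arranged with $a^2,b^2,c^2$ in the top row, $d^2,e^2,f^2$ in the middle row, $g^2,h^2,i^2$ in the bottom row). If a prime $p\equiv 1\pmod 4$ divides the central entry $e^2$ and a mid-edge entry (one of $b^2,d^2,f^2,h^2$), then $p\equiv 1 \pmod 8$ and the residue class of the square mod $p$ is, up to scaling and rotation, \[ \begin{array}{c|c|c} 1 & 0 & -1\\ \hline -2 & 0 & 2\\ \hline 1 & 0 & -1 \end{array}. \]
   Context: A magic square of squares is a $3\times 3$ grid of $9$ distinct integer squares such that the entries of each row, each column and both main diagonals sum to the same total $T$ (necessarily $T=3e^2$). It is primitive if the greatest common divisor of all its entries is $1$. The residue class mod $p$ of the square is the $3\times3$ grid of the residues of its entries in $\mathbb{F}_p$. Scaling means multiplying every entry of the residue class by the same nonzero quadratic residue mod $p$; rotation means rotating the grid by a multiple of $90^\circ$. -}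

module Defs where

open import Data.Nat as ℕ using (ℕ)
open import Data.Nat.Divisibility as ℕD using ()
open import Data.Integer using (ℤ; +_; -_; _+_; _*_; _-_; ∣_∣)
open import Data.Integer.Divisibility using (_∣_)
open import Data.Fin using (Fin; zero; suc)
open import Data.Product using (_×_; Σ; ∃; ∃-syntax)
open import Relation.Binary.PropositionalEquality using (_≡_)

-- A 3×3 grid of integers, indexed by (row, column), rows top to bottom.
Grid : Set
Grid = Fin 3 → Fin 3 → ℤ

grid : ℤ → ℤ → ℤ → ℤ → ℤ → ℤ → ℤ → ℤ → ℤ → Grid
grid x₁ x₂ x₃ x₄ x₅ x₆ x₇ x₈ x₉ zero          zero          = x₁
grid x₁ x₂ x₃ x₄ x₅ x₆ x₇ x₈ x₉ zero          (suc zero)    = x₂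
grid x₁ x₂ x₃ x₄ x₅ x₆ x₇ x₈ x₉ zero          (suc (suc _)) = x₃
grid x₁ x₂ x₃ x₄ x₅ x₆ x₇ x₈ x₉ (suc zero)    zero          = x₄
grid x₁ x₂ x₃ x₄ x₅ x₆ x₇ x₈ x₉ (suc zero)    (suc zero)    = x₅
grid x₁ x₂ x₃ x₄ x₅ x₆ x₇ x₈ x₉ (suc zero)    (suc (suc _)) = x₆
grid x₁ x₂ x₃ x₄ x₅ x₆ x₇ x₈ x₉ (suc (suc _)) zero          = x₇
grid x₁ x₂ x₃ x₄ x₅ x₆ x₇ x₈ x₉ (suc (suc _)) (suc zero)    = x₈
grid x₁ x₂ x₃ x₄ x₅ x₆ x₇ x₈ x₉ (suc (suc _)) (suc (suc _)) = x₉

rev : Fin 3 → Fin 3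
rev zero          = suc (suc zero)
rev (suc zero)    = suc zero
rev (suc (suc _)) = zero

rot90 : Grid → Grid
rot90 M i j = M (rev j) i

rotate : ℕ → Grid → Grid
rotate ℕ.zero    M = M
rotate (ℕ.suc k) M = rot90 (rotate k M)

sqGrid : Grid → Grid
sqGrid M i j = M i j * M i j

row col : Grid → Fin 3 → ℤ
row M i = M i zero + M i (suc zero) + M i (suc (suc zero))
col M j = M zero j + M (suc zero) j + M (suc (suc zero)) j

diag₁ diag₂ : Grid → ℤ
diag₁ M = M zero zero + M (suc zero) (suc zero) + M (suc (suc zero)) (suc (suc zero))
diag₂ M = M zero (suc (suc zero)) + M (suc zero) (suc zero) + M (suc (suc zero)) zero

IsMagic : Grid → Set
IsMagic M = Σ ℤ λ T →
  ((i : Fin 3) → row M i ≡ T) × ((j : Fin 3) → col M j ≡ T) ×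
  diag₁ M ≡ T × diag₂ M ≡ T

AllDistinct : Grid → Set
AllDistinct M = ∀ i j i' j' → M i j ≡ M i' j' → (i ≡ i') × (j ≡ j')

IsPrimitive : Grid → Set
IsPrimitive M = (n : ℕ) → (∀ i j → n ℕD.∣ ∣ M i j ∣) → n ≡ 1

IsMagicSquareOfSquares : Grid → Set
IsMagicSquareOfSquares R = IsMagic (sqGrid R) × AllDistinct (sqGrid R)

_≡[mod_]_ : ℤ → ℕ → ℤ → Set
x ≡[mod p ] y = (+ p) ∣ (x - y)

pattern₀ : Grid
pattern₀ = grid (+ 1) (+ 0) (- (+ 1))
                (- (+ 2)) (+ 0) (+ 2)
                (+ 1) (+ 0) (- (+ 1))

ResidueScaled : ℕ → Grid → ℤ → Grid → Set
ResidueScaled p M s P = ∀ i j → M i j ≡[mod p ] (s * P i j)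

-- A magic 3×3 grid is determined by its top corners A, C and centre E: it is
-- A·basisA + E·basisE + C·basisC.  If p divides E = e² and a mid-edge entry, then p divides
-- A + C or A − C, so modulo p the square is A·pattern₀ or A times its rotation, and p ∤ A
-- since otherwise p would divide every entry.  Two cells of that residue pattern say that
-- −1 and −2 are squares mod p, hence −1 is a fourth power mod p.  For p = 4m + 1 with m odd
-- Fermat's little theorem forbids this: x⁴ ≡ −y⁴ would give 1 ≡ x^(4m) ≡ −y^(4m) ≡ −1.

module Submission where

open import Defs
open import Data.Nat using (ℕ; _%_; _<_)
open import Data.Nat.Primality using (Prime)
open import Data.Integer using (ℤ; +_; _*_)
open import Data.Integer.Divisibility using (_∣_)
open import Data.Fin using (zero; suc)
open import Data.Product using (_×_; Σ; ∃-syntax)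
open import Data.Sum using (_⊎_)
open import Relation.Nullary using (¬_)
open import Relation.Binary.PropositionalEquality using (_≡_)

import Algebra.Properties.CommutativeSemiring.Binomial
import Algebra.Properties.Semiring.Exp
import Algebra.Properties.Semiring.Mult
open import Data.Empty using (⊥-elim)
open import Data.Fin as Fin using (toℕ; fromℕ; inject₁)
import Data.Fin.Properties as Fin
open import Data.Fin.Patterns using (0F; 1F; 2F)
open import Data.Integer using (-[1+_]; -1ℤ; 0ℤ; 1ℤ; _+_; _-_; -_; _^_)
open import Data.Integer.Divisibility.Signed renaming (_∣_ to _∣ˢ_)
import Data.Integer as ℤ using (∣_∣)
import Data.Integer.Properties as ℤ
open import Algebra.Properties.Monoid.Sum ℤ.+-0-monoid using (sum; sum-init-last)
open import Data.Integer.Tactic.RingSolver using (solve-∀)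
open import Data.Nat as ℕ using (zero; suc; z<s; s<s; _∸_)
open import Data.Nat.Combinatorics
  using (nCk+nC[k+1]≡[n+1]C[k+1]; nC1≡n; nCn≡1) renaming (_C_ to _choose_)
open import Data.Nat.DivMod using (_/_; m%n<n; m≡m%n+[m/n]*n; m∣n⇒o%n%m≡o%m)
import Data.Nat.Divisibility as ℕ
open import Data.Nat.Primality using (euclidsLemma; ¬prime[1])
import Data.Nat.Properties as ℕ
import Data.Nat.Tactic.RingSolver as ℕ
open import Data.Product using (_,_; proj₁)
open import Data.Sum as Sum using (inj₁; inj₂)
open import Data.Vec.Functional using (Vector; init; tail)
open import Function using (_∘_; _∘₂_; id; flip)
open import Relation.Nullary using (contradiction)
open import Relation.Binary.PropositionalEquality using (refl; sym; trans; cong; cong₂; subst; module ≡-Reasoning)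

module Binomial = Algebra.Properties.CommutativeSemiring.Binomial ℤ.+-*-commutativeSemiring
module Exp = Algebra.Properties.Semiring.Exp ℤ.+-*-semiring
module Mult = Algebra.Properties.Semiring.Mult ℤ.+-*-semiring

∣-combination : ∀ {d x y z} m n → m * x + n * y ≡ z → d ∣ˢ x → d ∣ˢ y → d ∣ˢ z
∣-combination m n eq d∣x d∣y = subst (_ ∣ˢ_) eq (∣m∣n⇒∣m+n (∣n⇒∣m*n m d∣x) (∣n⇒∣m*n n d∣y))

∣x-y⇒∣x^n-y^n : ∀ {d x y} → d ∣ˢ x - y → ∀ n → d ∣ˢ x ^ n - y ^ n
∣x-y⇒∣x^n-y^n         d∣x-y zero    = divides 0ℤ refl
∣x-y⇒∣x^n-y^n {x = x} {y} d∣x-y (suc n) =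
  ∣-combination x (y ^ n) (telescope x y (x ^ n) (y ^ n)) (∣x-y⇒∣x^n-y^n d∣x-y n) d∣x-y
  where
  telescope : ∀ x y a b → x * (a - b) + b * (x - y) ≡ x * a - y * b
  telescope = solve-∀

∣-sum : ∀ {d n} (t : Vector ℤ n) → (∀ i → d ∣ˢ t i) → d ∣ˢ sum t
∣-sum {n = zero}  t d∣t = divides 0ℤ refl
∣-sum {n = suc n} t d∣t = ∣m∣n⇒∣m+n (d∣t Fin.zero) (∣-sum (tail t) (d∣t ∘ Fin.suc))

prime∣*⇒∣⊎∣ : ∀ {p x y} → Prime p → + p ∣ˢ x * y → + p ∣ˢ x ⊎ + p ∣ˢ y
prime∣*⇒∣⊎∣ {x = x} {y} p-prime p∣xy = Sum.map ∣ᵤ⇒∣ ∣ᵤ⇒∣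
  (euclidsLemma ℤ.∣ x ∣ ℤ.∣ y ∣ p-prime (subst (_ ℕ.∣_) (ℤ.abs-* x y) (∣⇒∣ᵤ p∣xy)))

prime∣^⇒prime∣ : ∀ {p x} → Prime p → ∀ n → + p ∣ˢ x ^ suc n → + p ∣ˢ x
prime∣^⇒prime∣ {x = x} p-prime zero    p∣x^1 = subst (_ ∣ˢ_) (ℤ.*-identityʳ x) p∣x^1
prime∣^⇒prime∣ {x = x} p-prime (suc n) p∣x^n =
  Sum.[ id , prime∣^⇒prime∣ p-prime n ]′ (prime∣*⇒∣⊎∣ {x = x} p-prime p∣x^n)

-- Fermat's little theorem

[1+k]*[1+n]C[1+k]≡[1+n]*nCk : ∀ n k → suc k ℕ.* (suc n choose suc k) ≡ suc n ℕ.* (n choose k)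
[1+k]*[1+n]C[1+k]≡[1+n]*nCk zero    zero    = refl
[1+k]*[1+n]C[1+k]≡[1+n]*nCk zero    (suc k) = ℕ.*-zeroʳ (suc (suc k))
[1+k]*[1+n]C[1+k]≡[1+n]*nCk (suc m) zero    =
  trans (ℕ.+-identityʳ _) (trans (nC1≡n (suc (suc m))) (sym (ℕ.*-identityʳ _)))
[1+k]*[1+n]C[1+k]≡[1+n]*nCk (suc m) (suc k) = begin
  suc (suc k) ℕ.* (suc (suc m) choose suc (suc k))
    ≡⟨ cong (suc (suc k) ℕ.*_) (nCk+nC[k+1]≡[n+1]C[k+1] (suc m) (suc k)) ⟨
  suc (suc k) ℕ.* (X ℕ.+ Y)
    ≡⟨ distribute k X Y ⟩
  X ℕ.+ (suc k ℕ.* X ℕ.+ suc (suc k) ℕ.* Y)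
    ≡⟨ cong₂ (λ u v → X ℕ.+ (u ℕ.+ v)) ([1+k]*[1+n]C[1+k]≡[1+n]*nCk m k) ([1+k]*[1+n]C[1+k]≡[1+n]*nCk m (suc k)) ⟩
  X ℕ.+ (suc m ℕ.* (m choose k) ℕ.+ suc m ℕ.* (m choose suc k))
    ≡⟨ cong (X ℕ.+_) (ℕ.*-distribˡ-+ (suc m) (m choose k) (m choose suc k)) ⟨
  X ℕ.+ suc m ℕ.* (m choose k ℕ.+ m choose suc k)
    ≡⟨ cong (λ u → X ℕ.+ suc m ℕ.* u) (nCk+nC[k+1]≡[n+1]C[k+1] m k) ⟩
  X ℕ.+ suc m ℕ.* X
    ∎
  where
  open ≡-Reasoning
  X Y : ℕ
  X = suc m choose suc k
  Y = suc m choose suc (suc k)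
  distribute : ∀ k x y → suc (suc k) ℕ.* (x ℕ.+ y) ≡ x ℕ.+ (suc k ℕ.* x ℕ.+ suc (suc k) ℕ.* y)
  distribute = ℕ.solve-∀

prime∣pCk : ∀ {p k} → Prime p → 0 ℕ.< k → k ℕ.< p → p ℕ.∣ p choose k
prime∣pCk {suc n} {suc j} p-prime _ k<p
  with euclidsLemma (suc j) (suc n choose suc j) p-prime
         (ℕ.divides (n choose j) (trans ([1+k]*[1+n]C[1+k]≡[1+n]*nCk n j) (ℕ.*-comm (suc n) (n choose j))))
... | inj₁ p∣k = ⊥-elim (ℕ.<⇒≱ k<p (ℕ.∣⇒≤ p∣k))
... | inj₂ p∣C = p∣C

Exp^≡^ : ∀ x n → x Exp.^ n ≡ x ^ n
Exp^≡^ x zero    = refl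
Exp^≡^ x (suc n) = cong (x *_) (Exp^≡^ x n)

Mult×≡* : ∀ n x → n Mult.× x ≡ + n * x
Mult×≡* zero    x = sym (ℤ.*-zeroˡ x)
Mult×≡* (suc n) x = begin
  x + n Mult.× x   ≡⟨ cong (_+_ x) (Mult×≡* n x) ⟩
  x + + n * x      ≡⟨ cong (_+ + n * x) (ℤ.*-identityˡ x) ⟨
  1ℤ * x + + n * x ≡⟨ ℤ.*-distribʳ-+ x 1ℤ (+ n) ⟨
  + suc n * x      ∎
  where open ≡-Reasoning

binomialTerm-first : ∀ x n → Binomial.binomialTerm 1ℤ x n Fin.zero ≡ x ^ n
binomialTerm-first x n = begin
  1ℤ * x Exp.^ n + 0ℤ ≡⟨ ℤ.+-identityʳ _ ⟩
  1ℤ * x Exp.^ n      ≡⟨ ℤ.*-identityˡ _ ⟩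
  x Exp.^ n           ≡⟨ Exp^≡^ x n ⟩
  x ^ n               ∎
  where open ≡-Reasoning

binomialTerm-last : ∀ x n → Binomial.binomialTerm 1ℤ x n (fromℕ n) ≡ 1ℤ
binomialTerm-last x n = begin
  term (toℕ (fromℕ n))  ≡⟨ cong term (Fin.toℕ-fromℕ n) ⟩
  term n                ≡⟨ cong₂ (λ c e → c Mult.× (1ℤ Exp.^ n * x Exp.^ e)) (nCn≡1 n) (ℕ.n∸n≡0 n) ⟩
  1ℤ Exp.^ n * 1ℤ + 0ℤ  ≡⟨ ℤ.+-identityʳ _ ⟩
  1ℤ Exp.^ n * 1ℤ       ≡⟨ ℤ.*-identityʳ _ ⟩
  1ℤ Exp.^ n            ≡⟨ Exp^≡^ 1ℤ n ⟩
  1ℤ ^ n                ≡⟨ ℤ.^-zeroˡ n ⟩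
  1ℤ                    ∎
  where
  open ≡-Reasoning
  term : ℕ → ℤ
  term k = (n choose k) Mult.× (1ℤ Exp.^ k * x Exp.^ (n ∸ k))

prime∣[1+x]^p-x^p-1 : ∀ {p} → Prime p → ∀ x → + p ∣ˢ (1ℤ + x) ^ p - x ^ p - 1ℤ
prime∣[1+x]^p-x^p-1 {suc n} p-prime x = subst (+ p ∣ˢ_) (sym expansion) (∣-sum middle p∣middle)
  where
  open ≡-Reasoning
  p : ℕ
  p = suc n
  t : Vector ℤ (suc p)
  t = Binomial.binomialTerm 1ℤ x p
  middle : Vector ℤ n
  middle = init (tail t)
  p∣middle : ∀ j → + p ∣ˢ middle j
  p∣middle j = subst (+ p ∣ˢ_) (sym (Mult×≡* (p choose suc k) _))
    (∣m⇒∣m*n {m = + (p choose suc k)} _ (∣ᵤ⇒∣ (prime∣pCk p-prime z<s (s<s k<n))))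
    where
    k : ℕ
    k = toℕ (inject₁ j)
    k<n : k ℕ.< n
    k<n = subst (ℕ._< n) (sym (Fin.toℕ-inject₁ j)) (Fin.toℕ<n j)
  expansion : (1ℤ + x) ^ p - x ^ p - 1ℤ ≡ sum middle
  expansion = begin
    (1ℤ + x) ^ p - x ^ p - 1ℤ
      ≡⟨ cong (λ y → y - x ^ p - 1ℤ) (trans (sym (Exp^≡^ (1ℤ + x) p)) (Binomial.theorem p 1ℤ x)) ⟩
    t Fin.zero + sum (tail t) - x ^ p - 1ℤ
      ≡⟨ cong (λ y → t Fin.zero + y - x ^ p - 1ℤ) (sum-init-last (tail t)) ⟩
    t Fin.zero + (sum middle + t (fromℕ p)) - x ^ p - 1ℤ
      ≡⟨ cong₂ (λ y z → y + (sum middle + z) - x ^ p - 1ℤ) (binomialTerm-first x p) (binomialTerm-last x p) ⟩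
    x ^ p + (sum middle + 1ℤ) - x ^ p - 1ℤ
      ≡⟨ cancel (x ^ p) (sum middle) ⟩
    sum middle
      ∎
    where
    cancel : ∀ y z → y + (z + 1ℤ) - y - 1ℤ ≡ z
    cancel = solve-∀

fermat-little : ∀ {p} → Prime p → ∀ x → + p ∣ˢ x ^ p - x
fermat-little {suc n} p-prime = go
  where
  p : ℕ
  p = suc n
  shift : ∀ x → (1ℤ + x) ^ p - (1ℤ + x) ≡ ((1ℤ + x) ^ p - x ^ p - 1ℤ) + (x ^ p - x)
  shift x = regroup ((1ℤ + x) ^ p) (x ^ p) x
    where
    regroup : ∀ a b x → a - (1ℤ + x) ≡ (a - b - 1ℤ) + (b - x)
    regroup = solve-∀
  up : ∀ x → + p ∣ˢ x ^ p - x → + p ∣ˢ (1ℤ + x) ^ p - (1ℤ + x)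
  up x h = subst (+ p ∣ˢ_) (sym (shift x)) (∣m∣n⇒∣m+n (prime∣[1+x]^p-x^p-1 p-prime x) h)
  down : ∀ x → + p ∣ˢ (1ℤ + x) ^ p - (1ℤ + x) → + p ∣ˢ x ^ p - x
  down x h = ∣m+n∣m⇒∣n (subst (+ p ∣ˢ_) (shift x) h) (prime∣[1+x]^p-x^p-1 p-prime x)
  -- 1ℤ + + m and 1ℤ + -[1+ suc m ] compute to + suc m and -[1+ m ], so each step is definitional.
  go : ∀ x → + p ∣ˢ x ^ p - x
  go (+ zero)       = divides 0ℤ refl
  go (+ suc m)      = up (+ m) (go (+ m))
  go -[1+ zero ]    = down -[1+ zero ] (go (+ zero))
  go -[1+ suc m ]   = down -[1+ suc m ] (go -[1+ m ])

fermat-little-unit : ∀ {n x} → Prime (suc n) → ¬ + suc n ∣ˢ x → + suc n ∣ˢ x ^ n - 1ℤ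
fermat-little-unit {n} {x} p-prime p∤x =
  Sum.[ flip contradiction p∤x , id ]′
    (prime∣*⇒∣⊎∣ p-prime (subst (_ ∣ˢ_) (factor x (x ^ n)) (fermat-little p-prime x)))
  where
  factor : ∀ x a → x * a - x ≡ x * (a - 1ℤ)
  factor = solve-∀

-- Primes p ≡ 1 (mod 8)

p≡5[mod8]⇒p∤x⁴+y⁴ : ∀ {p q x y} → Prime p → p ≡ 5 ℕ.+ 8 ℕ.* q →
                    ¬ + p ∣ˢ y → ¬ + p ∣ˢ x ^ 4 + y ^ 4
p≡5[mod8]⇒p∤x⁴+y⁴ {q = q} {x} {y} p-prime refl p∤y p∣x⁴+y⁴ =
  ℕ.<⇒≱ (s<s (s<s z<s)) (ℕ.∣⇒≤ (∣⇒∣ᵤ p∣2))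
  where
  m : ℕ
  m = 4 ℕ.+ 8 ℕ.* q
  p∤x : ¬ + suc m ∣ˢ x
  p∤x p∣x = p∤y (prime∣^⇒prime∣ p-prime 3 (∣m+n∣m⇒∣n p∣x⁴+y⁴ (∣m⇒∣m*n (x ^ 3) p∣x)))
  split : ∀ z → z ^ m ≡ z ^ 4 * (z ^ 8) ^ q
  split z = trans (ℤ.^-distribˡ-+-* z 4 (8 ℕ.* q)) (cong (z ^ 4 *_) (sym (ℤ.^-*-assoc z 8 q)))
  p∣x⁸-y⁸ : + suc m ∣ˢ x ^ 8 - y ^ 8
  p∣x⁸-y⁸ = subst (_ ∣ˢ_) (trans (difference-of-squares (x ^ 4) (y ^ 4)) (cong₂ _-_ (square x) (square y)))
                    (∣n⇒∣m*n (x ^ 4 - y ^ 4) p∣x⁴+y⁴)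
    where
    difference-of-squares : ∀ a b → (a - b) * (a + b) ≡ a * a - b * b
    difference-of-squares = solve-∀
    square : ∀ z → z ^ 4 * z ^ 4 ≡ z ^ 8
    square z = sym (ℤ.^-distribˡ-+-* z 4 4)
  p∣x^m+y^m : + suc m ∣ˢ x ^ m + y ^ m
  p∣x^m+y^m = ∣-combination (x ^ 4) ((y ^ 8) ^ q)
    (trans (regroup (x ^ 4) (y ^ 4) ((x ^ 8) ^ q) ((y ^ 8) ^ q)) (sym (cong₂ _+_ (split x) (split y))))
    (∣x-y⇒∣x^n-y^n {x = x ^ 8} {y ^ 8} p∣x⁸-y⁸ q) p∣x⁴+y⁴
    where
    regroup : ∀ a b u v → a * (u - v) + v * (a + b) ≡ a * u + b * v
    regroup = solve-∀
  p∣2 : + suc m ∣ˢ + 2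
  p∣2 = subst (_ ∣ˢ_) (two (x ^ m) (y ^ m))
    (∣m∣n⇒∣m-n (∣m∣n⇒∣m-n p∣x^m+y^m (fermat-little-unit p-prime p∤x)) (fermat-little-unit p-prime p∤y))
    where
    two : ∀ a b → a + b - (a - 1ℤ) - (b - 1ℤ) ≡ + 2
    two = solve-∀

-- With γ = iα and δ = sα, where i² = −1 and s² = −2, the identity (1 + i)² = 2i gives
-- (γ(α + γ))⁴ = α⁸(2i)² = −4α⁸ = −(αδ)⁴; the cofactors below turn this into a polynomial identity.
squares⇒fourth-powers : ∀ {d α γ δ} → d ∣ˢ γ * γ - α * α * -1ℤ → d ∣ˢ δ * δ - α * α * - (+ 2) →
                        d ∣ˢ (γ * (α + γ)) ^ 4 + (α * δ) ^ 4
squares⇒fourth-powers {α = α} {γ} {δ} =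
  ∣-combination
    (γ * γ * (γ * (α + γ) * (γ * (α + γ)) + + 2 * α * γ * γ * γ)
       + + 4 * α * α * (γ * γ * γ * γ - γ * γ * α * α + α * α * α * α))
    (α * α * α * α * (δ * δ - + 2 * α * α))
    (certificate α γ δ)
  where
  certificate : ∀ a g e →
    (g * g * (g * (a + g) * (g * (a + g)) + + 2 * a * g * g * g)
       + + 4 * a * a * (g * g * g * g - g * g * a * a + a * a * a * a)) * (g * g - a * a * -1ℤ)
    + (a * a * a * a * (e * e - + 2 * a * a)) * (e * e - a * a * - (+ 2))
    ≡ (g * (a + g)) * ((g * (a + g)) * ((g * (a + g)) * ((g * (a + g)) * 1ℤ)))
      + (a * e) * ((a * e) * ((a * e) * ((a * e) * 1ℤ)))
  certificate = solve-∀

r<8∧r%4≡1⇒r≡1⊎r≡5 : ∀ {r} → r ℕ.< 8 → r % 4 ≡ 1 → r ≡ 1 ⊎ r ≡ 5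
r<8∧r%4≡1⇒r≡1⊎r≡5 {1} _ _ = inj₁ refl
r<8∧r%4≡1⇒r≡1⊎r≡5 {5} _ _ = inj₂ refl
r<8∧r%4≡1⇒r≡1⊎r≡5 {0} _ ()
r<8∧r%4≡1⇒r≡1⊎r≡5 {2} _ ()
r<8∧r%4≡1⇒r≡1⊎r≡5 {3} _ ()
r<8∧r%4≡1⇒r≡1⊎r≡5 {4} _ ()
r<8∧r%4≡1⇒r≡1⊎r≡5 {6} _ ()
r<8∧r%4≡1⇒r≡1⊎r≡5 {7} _ ()
r<8∧r%4≡1⇒r≡1⊎r≡5 {suc (suc (suc (suc (suc (suc (suc (suc _)))))))}
  (s<s (s<s (s<s (s<s (s<s (s<s (s<s (s<s ())))))))) _

p%4≡1⇒p%8≡1⊎p≡5+8q : ∀ p → p % 4 ≡ 1 → p % 8 ≡ 1 ⊎ ∃[ q ] p ≡ 5 ℕ.+ 8 ℕ.* q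
p%4≡1⇒p%8≡1⊎p≡5+8q p p%4≡1
  with r<8∧r%4≡1⇒r≡1⊎r≡5 (m%n<n p 8) (trans (m∣n⇒o%n%m≡o%m 4 8 p (ℕ.divides 2 refl)) p%4≡1)
... | inj₁ p%8≡1 = inj₁ p%8≡1
... | inj₂ p%8≡5 = inj₂ (p / 8 , (begin
  p                        ≡⟨ m≡m%n+[m/n]*n p 8 ⟩
  p % 8 ℕ.+ p / 8 ℕ.* 8    ≡⟨ cong₂ ℕ._+_ p%8≡5 (ℕ.*-comm (p / 8) 8) ⟩
  5 ℕ.+ 8 ℕ.* (p / 8)      ∎))
  where open ≡-Reasoning

squares[-1,-2]⇒p%8≡1 : ∀ {p α γ δ} → Prime p → p % 4 ≡ 1 → ¬ + p ∣ˢ α * α →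
                       + p ∣ˢ γ * γ - α * α * -1ℤ → + p ∣ˢ δ * δ - α * α * - (+ 2) → p % 8 ≡ 1
squares[-1,-2]⇒p%8≡1 {p} {α} {γ} {δ} p-prime p%4≡1 p∤α² p∣γ²+α² p∣δ²+2α²
  with p%4≡1⇒p%8≡1⊎p≡5+8q p p%4≡1
... | inj₁ p%8≡1      = p%8≡1
... | inj₂ (q , refl) =
  ⊥-elim (p≡5[mod8]⇒p∤x⁴+y⁴ {q = q} {x = γ * (α + γ)} p-prime refl p∤αδ
           (squares⇒fourth-powers {α = α} {γ} {δ} p∣γ²+α² p∣δ²+2α²))
  where
  p∤2 : ¬ + p ∣ˢ + 2
  p∤2 p∣2 = ℕ.<⇒≱ (s<s (s<s z<s)) (ℕ.∣⇒≤ (∣⇒∣ᵤ p∣2))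
  p∤δ : ¬ + p ∣ˢ δ
  p∤δ p∣δ = Sum.[ p∤α² , p∤2 ∘ ∣m⇒∣-m ]′
    (prime∣*⇒∣⊎∣ p-prime (subst (_ ∣ˢ_) (cancel α δ) (∣m∣n⇒∣m-n (∣m⇒∣m*n δ p∣δ) p∣δ²+2α²)))
    where
    cancel : ∀ a e → e * e - (e * e - a * a * - (+ 2)) ≡ a * a * - (+ 2)
    cancel = solve-∀
  p∤αδ : ¬ + p ∣ˢ α * δ
  p∤αδ = Sum.[ p∤α² ∘ ∣m⇒∣m*n {m = α} α , p∤δ ]′ ∘ prime∣*⇒∣⊎∣ p-prime

-- Magic 3×3 grids

basisA basisE basisC : Grid
basisA = grid (+ 1) -1ℤ   0ℤ
              -1ℤ   0ℤ    (+ 1)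
              0ℤ    (+ 1) -1ℤ
basisE = grid 0ℤ    (+ 3) 0ℤ
              (+ 1) (+ 1) (+ 1)
              (+ 2) -1ℤ   (+ 2)
basisC = grid 0ℤ    -1ℤ   (+ 1)
              (+ 1) 0ℤ    -1ℤ
              -1ℤ   (+ 1) 0ℤ

magicGrid : ℤ → ℤ → ℤ → Grid
magicGrid A E C i j = A * basisA i j + E * basisE i j + C * basisC i j

magic-sum≡3*centre : ∀ {M} (magic : IsMagic M) → proj₁ magic ≡ + 3 * M 1F 1F
magic-sum≡3*centre {M} (T , row≡T , col≡T , diag₁≡T , diag₂≡T) = begin
  T ≡⟨ thrice T ⟩
  T + T + T - T - T
    ≡⟨ cong₂ _-_ (cong₂ _-_ (cong₂ _+_ (cong₂ _+_ diag₁≡T diag₂≡T) (col≡T 1F)) (row≡T 0F)) (row≡T 2F) ⟨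
  diag₁ M + diag₂ M + col M 1F - row M 0F - row M 2F
    ≡⟨ lines (M 0F 0F) (M 0F 1F) (M 0F 2F) (M 1F 1F) (M 2F 0F) (M 2F 1F) (M 2F 2F) ⟩
  + 3 * M 1F 1F ∎
  where
  open ≡-Reasoning
  thrice : ∀ t → t ≡ t + t + t - t - t
  thrice = solve-∀
  lines : ∀ a b c e g h i → (a + e + i) + (c + e + g) + (b + e + h) - (a + b + c) - (g + h + i) ≡ + 3 * e
  lines = solve-∀

magic⇒≗magicGrid : ∀ {M} → IsMagic M → ∀ i j → M i j ≡ magicGrid (M 0F 0F) (M 1F 1F) (M 0F 2F) i j
magic⇒≗magicGrid {M} magic@(T , row≡T , col≡T , diag₁≡T , diag₂≡T) = λ where
    0F 0F → A≡
    0F 1F → B≡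
    0F 2F → C≡
    1F 0F → D≡
    1F 1F → E≡
    1F 2F → F≡
    2F 0F → G≡
    2F 1F → H≡
    2F 2F → I≡
  where
  A B C D E F G H I : ℤ
  A = M 0F 0F
  B = M 0F 1F
  C = M 0F 2F
  D = M 1F 0F
  E = M 1F 1F
  F = M 1F 2F
  G = M 2F 0F
  H = M 2F 1F
  I = M 2F 2F
  ≡-from-difference : ∀ {x e z} → x - e ≡ z → z ≡ 0ℤ → x ≡ e
  ≡-from-difference x-e≡z z≡0 = ℤ.i-j≡0⇒i≡j _ _ (trans x-e≡z z≡0)
  same-sum⇒difference≡0 : ∀ {x y S} → x ≡ S → y ≡ S → x - y ≡ 0ℤ
  same-sum⇒difference≡0 {S = S} refl refl = ℤ.+-inverseʳ S
  line-3E≡0 : ∀ {x} → x ≡ T → x - + 3 * E ≡ 0ℤ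
  line-3E≡0 x≡T = same-sum⇒difference≡0 x≡T (sym (magic-sum≡3*centre {M} magic))
  A≡ : A ≡ magicGrid A E C 0F 0F
  A≡ = ≡-from-difference (certificate A E C) refl
    where
    certificate : ∀ a e c → a - (a * + 1 + e * 0ℤ + c * 0ℤ) ≡ 0ℤ
    certificate = solve-∀
  C≡ : C ≡ magicGrid A E C 0F 2F
  C≡ = ≡-from-difference (certificate A E C) refl
    where
    certificate : ∀ a e c → c - (a * 0ℤ + e * 0ℤ + c * + 1) ≡ 0ℤ
    certificate = solve-∀
  E≡ : E ≡ magicGrid A E C 1F 1F
  E≡ = ≡-from-difference (certificate A E C) refl
    where
    certificate : ∀ a e c → e - (a * 0ℤ + e * + 1 + c * 0ℤ) ≡ 0ℤ
    certificate = solve-∀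
  B≡ : B ≡ magicGrid A E C 0F 1F
  B≡ = ≡-from-difference (certificate A B C E) (line-3E≡0 (row≡T 0F))
    where
    certificate : ∀ a b c e → b - (a * -1ℤ + e * + 3 + c * -1ℤ) ≡ (a + b + c) - + 3 * e
    certificate = solve-∀
  D≡ : D ≡ magicGrid A E C 1F 0F
  D≡ = ≡-from-difference (certificate A C D E G) (same-sum⇒difference≡0 (col≡T 0F) diag₂≡T)
    where
    certificate : ∀ a c d e g → d - (a * -1ℤ + e * + 1 + c * + 1) ≡ (a + d + g) - (c + e + g)
    certificate = solve-∀
  F≡ : F ≡ magicGrid A E C 1F 2F
  F≡ = ≡-from-difference (certificate A C E F I) (same-sum⇒difference≡0 (col≡T 2F) diag₁≡T)
    where
    certificate : ∀ a c e f i → f - (a * + 1 + e * + 1 + c * -1ℤ) ≡ (c + f + i) - (a + e + i)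
    certificate = solve-∀
  G≡ : G ≡ magicGrid A E C 2F 0F
  G≡ = ≡-from-difference (certificate A C E G) (line-3E≡0 diag₂≡T)
    where
    certificate : ∀ a c e g → g - (a * 0ℤ + e * + 2 + c * -1ℤ) ≡ (c + e + g) - + 3 * e
    certificate = solve-∀
  H≡ : H ≡ magicGrid A E C 2F 1F
  H≡ = ≡-from-difference (certificate A B C E H) (same-sum⇒difference≡0 (col≡T 1F) (row≡T 0F))
    where
    certificate : ∀ a b c e h → h - (a * + 1 + e * -1ℤ + c * + 1) ≡ (b + e + h) - (a + b + c)
    certificate = solve-∀
  I≡ : I ≡ magicGrid A E C 2F 2F
  I≡ = ≡-from-difference (certificate A C E I) (line-3E≡0 diag₁≡T)
    where
    certificate : ∀ a c e i → i - (a * -1ℤ + e * + 2 + c * 0ℤ) ≡ (a + e + i) - + 3 * e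
    certificate = solve-∀

pattern₀≗basisA-basisC : ∀ i j → pattern₀ i j ≡ basisA i j - basisC i j
pattern₀≗basisA-basisC = λ where
  0F 0F → refl ; 0F 1F → refl ; 0F 2F → refl
  1F 0F → refl ; 1F 1F → refl ; 1F 2F → refl
  2F 0F → refl ; 2F 1F → refl ; 2F 2F → refl

rotate1-pattern₀≗basisA+basisC : ∀ i j → rotate 1 pattern₀ i j ≡ basisA i j + basisC i j
rotate1-pattern₀≗basisA+basisC = λ where
  0F 0F → refl ; 0F 1F → refl ; 0F 2F → refl
  1F 0F → refl ; 1F 1F → refl ; 1F 2F → refl
  2F 0F → refl ; 2F 1F → refl ; 2F 2F → refl

magicGrid-residue⁺ : ∀ {d A E C} → d ∣ˢ E → d ∣ˢ A + C →
                     ∀ i j → d ∣ˢ magicGrid A E C i j - A * pattern₀ i j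
magicGrid-residue⁺ {A = A} {E} {C} d∣E d∣A+C i j =
  ∣-combination (basisE i j) (basisC i j) (begin
    basisE i j * E + basisC i j * (A + C)
      ≡⟨ regroup A E C (basisA i j) (basisE i j) (basisC i j) ⟩
    magicGrid A E C i j - A * (basisA i j - basisC i j)
      ≡⟨ cong (λ P → magicGrid A E C i j - A * P) (pattern₀≗basisA-basisC i j) ⟨
    magicGrid A E C i j - A * pattern₀ i j
      ∎) d∣E d∣A+C
  where
  open ≡-Reasoning
  regroup : ∀ a e c x y z → y * e + z * (a + c) ≡ a * x + e * y + c * z - a * (x - z)
  regroup = solve-∀

magicGrid-residue⁻ : ∀ {d A E C} → d ∣ˢ E → d ∣ˢ A - C →
                     ∀ i j → d ∣ˢ magicGrid A E C i j - A * rotate 1 pattern₀ i j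
magicGrid-residue⁻ {A = A} {E} {C} d∣E d∣A-C i j =
  ∣-combination (basisE i j) (- basisC i j) (begin
    basisE i j * E + - basisC i j * (A - C)
      ≡⟨ regroup A E C (basisA i j) (basisE i j) (basisC i j) ⟩
    magicGrid A E C i j - A * (basisA i j + basisC i j)
      ≡⟨ cong (λ P → magicGrid A E C i j - A * P) (rotate1-pattern₀≗basisA+basisC i j) ⟨
    magicGrid A E C i j - A * rotate 1 pattern₀ i j
      ∎) d∣E d∣A-C
  where
  open ≡-Reasoning
  regroup : ∀ a e c x y z → y * e + - z * (a - c) ≡ a * x + e * y + c * z - a * (x + z)
  regroup = solve-∀

magic⇒mid-edge-residue : ∀ {d M} → IsMagic M → d ∣ˢ M 1F 1F →
  d ∣ˢ M 0F 1F ⊎ d ∣ˢ M 1F 0F ⊎ d ∣ˢ M 1F 2F ⊎ d ∣ˢ M 2F 1F →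
  (∀ i j → d ∣ˢ M i j - M 0F 0F * pattern₀ i j) ⊎ (∀ i j → d ∣ˢ M i j - M 0F 0F * rotate 1 pattern₀ i j)
magic⇒mid-edge-residue {d} {M} magic d∣E d∣mid =
  Sum.map (transport {pattern₀} ∘ magicGrid-residue⁺ {A = A} {E} {C} d∣E)
          (transport {rotate 1 pattern₀} ∘ magicGrid-residue⁻ {A = A} {E} {C} d∣E)
    (corner-relation d∣mid)
  where
  A E C : ℤ
  A = M 0F 0F
  E = M 1F 1F
  C = M 0F 2F
  M≗ : ∀ i j → M i j ≡ magicGrid A E C i j
  M≗ = magic⇒≗magicGrid {M} magic
  transport : ∀ {P} → (∀ i j → d ∣ˢ magicGrid A E C i j - A * P i j) → ∀ i j → d ∣ˢ M i j - A * P i j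
  transport {P} d∣M′-AP i j = subst (λ x → d ∣ˢ x - A * P i j) (sym (M≗ i j)) (d∣M′-AP i j)
  via : ∀ {i j} → d ∣ˢ M i j → d ∣ˢ magicGrid A E C i j
  via {i} {j} = subst (d ∣ˢ_) (M≗ i j)
  corner-relation : d ∣ˢ M 0F 1F ⊎ d ∣ˢ M 1F 0F ⊎ d ∣ˢ M 1F 2F ⊎ d ∣ˢ M 2F 1F →
                    d ∣ˢ A + C ⊎ d ∣ˢ A - C
  corner-relation (inj₁ d∣B) = inj₁ (∣-combination (+ 3) -1ℤ (top A E C) d∣E (via d∣B))
    where
    top : ∀ a e c → + 3 * e + -1ℤ * (a * -1ℤ + e * + 3 + c * -1ℤ) ≡ a + c
    top = solve-∀
  corner-relation (inj₂ (inj₁ d∣D)) = inj₂ (∣-combination (+ 1) -1ℤ (left A E C) d∣E (via d∣D))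
    where
    left : ∀ a e c → + 1 * e + -1ℤ * (a * -1ℤ + e * + 1 + c * + 1) ≡ a - c
    left = solve-∀
  corner-relation (inj₂ (inj₂ (inj₁ d∣F))) = inj₂ (∣-combination -1ℤ (+ 1) (right A E C) d∣E (via d∣F))
    where
    right : ∀ a e c → -1ℤ * e + + 1 * (a * + 1 + e * + 1 + c * -1ℤ) ≡ a - c
    right = solve-∀
  corner-relation (inj₂ (inj₂ (inj₂ d∣H))) = inj₁ (∣-combination (+ 1) (+ 1) (bottom A E C) d∣E (via d∣H))
    where
    bottom : ∀ a e c → + 1 * e + + 1 * (a * + 1 + e * -1ℤ + c * + 1) ≡ a + c
    bottom = solve-∀

primitive⇒prime∤scale : ∀ {p s} {M P : Grid} → IsPrimitive M → Prime p →
                        (∀ i j → + p ∣ˢ M i j - s * P i j) → ¬ + p ∣ˢ s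
primitive⇒prime∤scale {p} {s} {M} {P} M-primitive p-prime p∣M-sP p∣s =
  ¬prime[1] (subst Prime (M-primitive p p∣M) p-prime)
  where
  p∣M : ∀ i j → + p ∣ M i j
  p∣M i j = ∣⇒∣ᵤ (subst (_ ∣ˢ_) (cancel (M i j) (s * P i j))
                         (∣m∣n⇒∣m+n (p∣M-sP i j) (∣m⇒∣m*n (P i j) p∣s)))
    where
    cancel : ∀ x y → x - y + y ≡ x
    cancel = solve-∀

primitive-magic⇒residue : ∀ {p M} → IsMagic M → IsPrimitive M → Prime p → + p ∣ˢ M 1F 1F →
  + p ∣ˢ M 0F 1F ⊎ + p ∣ˢ M 1F 0F ⊎ + p ∣ˢ M 1F 2F ⊎ + p ∣ˢ M 2F 1F →
  ¬ + p ∣ˢ M 0F 0F ×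
  ((∀ i j → + p ∣ˢ M i j - M 0F 0F * pattern₀ i j) ⊎ (∀ i j → + p ∣ˢ M i j - M 0F 0F * rotate 1 pattern₀ i j))
primitive-magic⇒residue {M = M} magic M-primitive p-prime p∣E p∣mid
  with magic⇒mid-edge-residue {M = M} magic p∣E p∣mid
... | inj₁ p∣M-AP =
  primitive⇒prime∤scale {M = M} {P = pattern₀} M-primitive p-prime p∣M-AP , inj₁ p∣M-AP
... | inj₂ p∣M-AP =
  primitive⇒prime∤scale {M = M} {P = rotate 1 pattern₀} M-primitive p-prime p∣M-AP , inj₂ p∣M-AP

corollary4p3 : (a b c d e f g h i : ℤ) → (p : ℕ) →
    let R = grid a b c d e f g h i in
    IsMagicSquareOfSquares R → IsPrimitive (sqGrid R) →
    Prime p → p % 4 ≡ 1 →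
    (+ p) ∣ (e * e) →
    ((+ p) ∣ (b * b) ⊎ (+ p) ∣ (d * d) ⊎ (+ p) ∣ (f * f) ⊎ (+ p) ∣ (h * h)) →
    (p % 8 ≡ 1) ×
    (Σ ℤ λ k → ¬ ((+ p) ∣ k) × Σ ℕ λ r → r < 4 ×
      ResidueScaled p (sqGrid R) (k * k) (rotate r pattern₀))
corollary4p3 a b c d e f g h i p (magic , _) M-primitive p-prime p%4≡1 p∣e² p∣mid
  with primitive-magic⇒residue {M = sqGrid (grid a b c d e f g h i)} magic M-primitive p-prime
         (∣ᵤ⇒∣ p∣e²) (Sum.map ∣ᵤ⇒∣ (Sum.map ∣ᵤ⇒∣ (Sum.map ∣ᵤ⇒∣ ∣ᵤ⇒∣)) p∣mid)
... | p∤a² , inj₁ p∣M-a²P =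
  squares[-1,-2]⇒p%8≡1 {α = a} {c} {d} p-prime p%4≡1 p∤a² (p∣M-a²P 0F 2F) (p∣M-a²P 1F 0F) ,
  a , p∤a² ∘ ∣m⇒∣m*n {m = a} a ∘ ∣ᵤ⇒∣ , 0 , z<s , ∣⇒∣ᵤ ∘₂ p∣M-a²P
... | p∤a² , inj₂ p∣M-a²P =
  squares[-1,-2]⇒p%8≡1 {α = a} {g} {b} p-prime p%4≡1 p∤a² (p∣M-a²P 2F 0F) (p∣M-a²P 0F 1F) ,
  a , p∤a² ∘ ∣m⇒∣m*n {m = a} a ∘ ∣ᵤ⇒∣ , 1 , s<s z<s , ∣⇒∣ᵤ ∘₂ p∣M-a²P
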